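{- The only $\theta$-free bipartite matching covered graphs are $K_2$ and the even cycles (including $C_2$).
   Context: Graphs loopless; multiple edges allowed; $C_2$ is two vertices joined by two parallel edges, $\theta$ is two vertices joined by three parallel edges. A connected graph with at least two vertices is matching covered if every edge lies in a perfect matching. A subgraph $H$ of $G$ is conformal if $G-V(H)$ has a perfect matching; $G$ is $\theta$-free if it has no conformal subgraph that is a bisubdivision of $\theta$ (obtained by replacing some edges of $\theta$ by paths with an even number of internal vertices). -}

module Defs where

open import Data.Nat as ℕ using (ℕ; zero; suc; _*_; _<?_; s≤s)
open import Data.Fin using (Fin; zero; suc; toℕ; fromℕ<)
open import Data.Bool using (Bool; true; false)
open import Data.Product using (Σ; ∃; ∃-syntax; _×_; _,_; proj₁; proj₂)
open import Data.Sum using (_⊎_)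
open import Data.List using (List; []; _∷_; _++_; length)
open import Data.List.Membership.Propositional using (_∈_; _∉_)
open import Data.List.Relation.Unary.Unique.Propositional using (Unique)
open import Relation.Binary.PropositionalEquality using (_≡_; _≢_)
open import Relation.Nullary using (yes; no; ¬_)
open import Function.Bundles using (_↔_; Inverse)

-- Finite multigraphs: vertices Fin V, edges Fin E, each edge has two
-- ends.  (Parallel edges allowed; looplessness is a separate predicate.)

record Graph : Set where
  field
    V    : ℕ
    E    : ℕ
    ends : Fin E → Fin V × Fin V

open Graph public

module _ (G : Graph) where

  Loopless : Set
  Loopless = ∀ (e : Fin (E G)) → proj₁ (ends G e) ≢ proj₂ (ends G e)

  Joins : Fin (E G) → Fin (V G) → Fin (V G) → Set
  Joins e x y = (ends G e ≡ (x , y)) ⊎ (ends G e ≡ (y , x))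

  Incident : Fin (V G) → Fin (E G) → Set
  Incident x e = (proj₁ (ends G e) ≡ x) ⊎ (proj₂ (ends G e) ≡ x)

  Bipartite : Set
  Bipartite = Σ (Fin (V G) → Bool) λ c →
    ∀ e → c (proj₁ (ends G e)) ≢ c (proj₂ (ends G e))

  data Walk : Fin (V G) → Fin (V G) → Set where
    [] : ∀ {x} → Walk x x
    step : ∀ {x y z} (e : Fin (E G)) → Joins e x y → Walk y z → Walk x z

  walkVerts : ∀ {x y} → Walk x y → List (Fin (V G))
  walkVerts {x} [] = x ∷ []
  walkVerts {x} (step e _ w) = x ∷ walkVerts w

  walkEdges : ∀ {x y} → Walk x y → List (Fin (E G))
  walkEdges [] = []
  walkEdges (step e _ w) = e ∷ walkEdges w

  IsPath : ∀ {x y} → Walk x y → Set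
  IsPath w = Unique (walkVerts w)

  Connected : Set
  Connected = ∀ (x y : Fin (V G)) → Walk x y

  -- M (edges marked true) is a perfect matching of the subgraph
  -- G - S (S a list of deleted vertices): no M-edge touches S, and
  -- every vertex not in S is an end of exactly one M-edge.
  PerfectMatchingAvoiding : List (Fin (V G)) → (Fin (E G) → Bool) → Set
  PerfectMatchingAvoiding S M =
    (∀ e → M e ≡ true → ∀ x → Incident x e → x ∉ S) ×
    (∀ x → x ∉ S → Σ (Fin (E G)) λ e → (M e ≡ true) × Incident x e ×
        (∀ e′ → M e′ ≡ true → Incident x e′ → e′ ≡ e))

  IsPerfectMatching : (Fin (E G) → Bool) → Set
  IsPerfectMatching M = PerfectMatchingAvoiding [] M

  MatchingCovered : Set
  MatchingCovered =
    Connected × (2 ℕ.≤ V G) ×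
    (∀ (e : Fin (E G)) → Σ (Fin (E G) → Bool) λ M → IsPerfectMatching M × M e ≡ true)

  Odd : ℕ → Set
  Odd k = ∃[ j ] k ≡ suc (2 * j)

  -- A subgraph of G that is a bisubdivision of θ: two distinct
  -- vertices u, v joined by three paths, each of odd length (i.e. an
  -- even number of internal vertices), pairwise internally disjoint and
  -- using pairwise distinct edges.
  record ThetaBisubdivision : Set where
    field
      u v : Fin (V G)
      u≢v : u ≢ v
      P₁ P₂ P₃ : Walk u v
      path₁ : IsPath P₁
      path₂ : IsPath P₂
      path₃ : IsPath P₃
      odd₁ : Odd (length (walkEdges P₁))
      odd₂ : Odd (length (walkEdges P₂))
      odd₃ : Odd (length (walkEdges P₃))
      disj₁₂ : ∀ z → z ∈ walkVerts P₁ → z ∈ walkVerts P₂ → (z ≡ u) ⊎ (z ≡ v)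
      disj₁₃ : ∀ z → z ∈ walkVerts P₁ → z ∈ walkVerts P₃ → (z ≡ u) ⊎ (z ≡ v)
      disj₂₃ : ∀ z → z ∈ walkVerts P₂ → z ∈ walkVerts P₃ → (z ≡ u) ⊎ (z ≡ v)
      edgesDistinct : Unique (walkEdges P₁ ++ walkEdges P₂ ++ walkEdges P₃)

    vertices : List (Fin (V G))
    vertices = walkVerts P₁ ++ walkVerts P₂ ++ walkVerts P₃

  Conformal : ThetaBisubdivision → Set
  Conformal H = Σ (Fin (E G) → Bool) λ M →
    PerfectMatchingAvoiding (ThetaBisubdivision.vertices H) M

  ThetaFree : Set
  ThetaFree = ∀ (H : ThetaBisubdivision) → ¬ Conformal H

_≅_ : Graph → Graph → Set
G ≅ H = Σ (Fin (V G) ↔ Fin (V H)) λ f → Σ (Fin (E G) ↔ Fin (E H)) λ g →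
  ∀ e → Joins H (Inverse.to g e) (Inverse.to f (proj₁ (ends G e)))
                                 (Inverse.to f (proj₂ (ends G e)))

K₂ : Graph
K₂ = record { V = 2 ; E = 1 ; ends = λ _ → (zero , suc zero) }

next : ∀ {n} → Fin (suc n) → Fin (suc n)
next {n} i with toℕ i <? n
... | yes p = fromℕ< (s≤s p)
... | no _  = zero

Cycle : ℕ → Graph
Cycle n = record { V = suc n ; E = suc n ; ends = λ i → (i , next i) }

-- the even cycle C_{2(j+1)}; EvenCycle 0 = C₂ (two parallel edges)
EvenCycle : ℕ → Graph
EvenCycle j = Cycle (suc (2 * j))

{-# OPTIONS --safe #-}

-- A θ-bisubdivision has a vertex incident with three distinct edges, while K₂ and the cycles
-- have none; this gives one direction.
--
-- Conversely, let x be incident with three distinct edges of a bipartite matching covered graph,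
-- and let M, N₂, N₃ be perfect matchings through them. Following N₂ from the colour class of x
-- and M from the other one is a permutation of the vertices; the orbit of x is the M–N₂
-- alternating cycle C. The M–N₃ alternating walk Q from x first returns to C at a vertex w of
-- the other colour class, since C is closed under M. The two arcs of C from x to w and this part
-- of Q are internally disjoint paths of odd length, and the set of their vertices is closed
-- under M, so M restricts to a perfect matching of the rest of the graph: G has a conformal
-- θ-bisubdivision. Hence a θ-free bipartite matching covered graph has maximum degree two.
-- If some vertex has two edges, the alternating cycle of the perfect matchings through them is
-- closed under adjacency and so, by connectivity, spans an even cycle; otherwise G is K₂.

module Submission where

open import Defs
open import Data.Bool using (Bool; true; not; if_then_else_)
open import Data.Bool.Properties using (¬-not; not-¬; not-injective; T-≡) renaming (_≟_ to _≟ᵇ_)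
open import Data.Empty using (⊥; ⊥-elim)
open import Data.Fin as Fin using (Fin; toℕ; fromℕ<)
open import Data.Fin.Properties
  using (pigeonhole; toℕ-fromℕ<; toℕ<n; toℕ-injective; any?) renaming (_≟_ to _≟ᶠ_)
open import Data.List as List using (List; []; _∷_; _++_; _∷ʳ_; length; applyUpTo)
open import Data.List.Properties using (unfold-reverse; length-applyUpTo)
open import Data.List.Membership.Propositional.Properties
  using (∈-applyUpTo⁺; ∈-applyUpTo⁻; ∈-++⁻; ∈-++⁺ˡ; ∈-++⁺ʳ)
open import Data.List.Membership.Propositional using (_∈_; _∉_)
import Data.List.Membership.DecPropositional as DecMembership
import Data.List.Relation.Unary.All as All
open import Data.List.Relation.Unary.AllPairs using (_∷_)
open import Data.List.Relation.Unary.Any using (here; there)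
import Data.List.Relation.Unary.Any.Properties as Any
import Data.List.Relation.Binary.Permutation.Setoid as Perm
import Data.List.Relation.Binary.Permutation.Setoid.Properties as PermProperties
open import Data.List.Relation.Unary.Unique.Propositional using (Unique)
open import Data.List.Relation.Unary.Unique.Propositional.Properties using (applyUpTo⁺₁; ++⁺)
open import Data.List.Relation.Binary.Disjoint.Propositional using (Disjoint)
open import Data.Nat using (ℕ; zero; suc; _+_; _*_; _∸_; _≤_; _<_; _<?_; z≤n; s≤s; s≤s⁻¹; z<s; pred)
open import Data.Nat.GeneralisedArithmetic using (iterate)
open import Data.Nat.Properties
open import Data.Product as Product using (Σ; ∃-syntax; _×_; _,_; proj₁; proj₂; swap)
open import Data.Sum as Sum using (_⊎_; inj₁; inj₂; [_,_]′)
open import Function.Base using (_∘_)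
open import Function.Bundles using (_↔_; Equivalence; Inverse; Injection; mk⤖)
open import Function.Properties.Bijection using (⤖⇒↔)
open import Function.Properties.Inverse using (↔-sym; ↔⇒↣)
open import Function.Definitions using (Injective; Surjective; Bijective)
open import Relation.Binary.PropositionalEquality
open import Relation.Binary.Definitions using (tri<; tri≈; tri>)
open import Relation.Nullary using (¬_; Dec; yes; no; does; ¬?; _×-dec_; _⊎-dec_)
open import Relation.Nullary.Decidable using (isYes; toWitness; fromWitness)

least : {P : ℕ → Set} → (∀ n → Dec (P n)) → ∀ {n} → P n →
  ∃[ m ] (P m × ∀ {i} → i < m → ¬ P i)
least P? {zero} p = 0 , p , λ ()
least {P} P? {suc n} p with P? 0
... | yes p₀ = 0 , p₀ , λ ()
... | no ¬p₀ with least {P ∘ suc} (P? ∘ suc) p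
...   | m , pm , below = suc m , pm , below′
  where
  below′ : ∀ {i} → i < suc m → ¬ P i
  below′ {zero} _ = ¬p₀
  below′ {suc i} (s≤s i<m) = below i<m

Even : ℕ → Set
Even n = ∃[ j ] n ≡ 2 * j

Even-suc : ∀ {n} → Even (suc n) → ∃[ j ] suc n ≡ suc (suc (2 * j))
Even-suc (suc j , n≡) = j , trans n≡ (*-suc 2 j)

Unique-reverse : {A : Set} {xs : List A} → Unique xs → Unique (List.reverse xs)
Unique-reverse {A} {xs} = Unique-resp-↭ (↭-sym (↭-reverse xs))
  where
  open Perm (setoid A) using (↭-sym)
  open PermProperties (setoid A) using (Unique-resp-↭; ↭-reverse)

Unique-++⇒≢ : {A : Set} (xs : List A) {ys : List A} → Unique (xs ++ ys) →
  ∀ {a b} → a ∈ xs → b ∈ ys → a ≢ b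
Unique-++⇒≢ (_ ∷ xs) (a∉ ∷ _) (here refl) b∈ = All.lookup a∉ (∈-++⁺ʳ xs b∈)
Unique-++⇒≢ (_ ∷ xs) (_ ∷ unique) (there a∈) b∈ = Unique-++⇒≢ xs unique a∈ b∈

Unique-++⁻ʳ : {A : Set} (xs : List A) {ys : List A} → Unique (xs ++ ys) → Unique ys
Unique-++⁻ʳ [] unique = unique
Unique-++⁻ʳ (_ ∷ xs) (_ ∷ unique) = Unique-++⁻ʳ xs unique

-- Iteration and orbits

module _ {A : Set} (f : A → A) where

  iterate-suc : ∀ x n → iterate f x (suc n) ≡ f (iterate f x n)
  iterate-suc x zero = refl
  iterate-suc x (suc n) = iterate-suc (f x) n

  iterate-+ : ∀ x m n → iterate f x (m + n) ≡ iterate f (iterate f x m) n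
  iterate-+ x zero n = refl
  iterate-+ x (suc m) n = iterate-+ (f x) m n

  iterate-comm : ∀ x m n → iterate f (iterate f x m) n ≡ iterate f (iterate f x n) m
  iterate-comm x m n = begin
    iterate f (iterate f x m) n ≡⟨ iterate-+ x m n ⟨
    iterate f x (m + n)         ≡⟨ cong (iterate f x) (+-comm m n) ⟩
    iterate f x (n + m)         ≡⟨ iterate-+ x n m ⟩
    iterate f (iterate f x n) m ∎
    where open ≡-Reasoning

  iterate-injective : Injective _≡_ _≡_ f → ∀ n → Injective _≡_ _≡_ (λ x → iterate f x n)
  iterate-injective f-inj zero eq = eq
  iterate-injective f-inj (suc n) eq = f-inj (iterate-injective f-inj n eq)

module Orbit {n} (f : Fin n → Fin n) (f-injective : Injective _≡_ _≡_ f) (x : Fin n) where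

  private
    collision⇒return : ∀ i d → iterate f x i ≡ iterate f x (i + d) → iterate f x d ≡ x
    collision⇒return i d eq = iterate-injective f f-injective i (begin
      iterate f (iterate f x d) i ≡⟨ iterate-comm f x d i ⟩
      iterate f (iterate f x i) d ≡⟨ iterate-+ f x i d ⟨
      iterate f x (i + d)         ≡⟨ eq ⟨
      iterate f x i               ∎)
      where open ≡-Reasoning

    return-between : ∀ {i j} → i < j → iterate f x i ≡ iterate f x j →
      ∃[ d ] (i + suc d ≡ j × iterate f x (suc d) ≡ x)
    return-between {i} {j} i<j eq with m≤n⇒∃[o]m+o≡n i<j
    ... | d , i+1+d≡j = d , j≡ , collision⇒return i (suc d) (trans eq (cong (iterate f x) (sym j≡)))
      where
      j≡ : i + suc d ≡ j
      j≡ = trans (+-suc i d) i+1+d≡j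

    opaque
      first-return : ∃[ p ] (iterate f x (suc p) ≡ x × ∀ {k} → k < p → iterate f x (suc k) ≢ x)
      first-return with pigeonhole (n<1+n n) (λ (i : Fin (suc n)) → iterate f x (toℕ i))
      ... | i , j , i<j , eq with return-between i<j eq
      ...   | d , _ , returns = least (λ p → iterate f x (suc p) ≟ᶠ x) {d} returns

  period : ℕ
  period = suc (proj₁ first-return)

  iterate-period : iterate f x period ≡ x
  iterate-period = proj₁ (proj₂ first-return)

  private
    no-early-return : ∀ {i j} → i < j → j < period → iterate f x i ≢ iterate f x j
    no-early-return {i} i<j j<period eq with return-between i<j eq
    ... | d , refl , returns = proj₂ (proj₂ first-return) (m+n≤o⇒n≤o i (s≤s⁻¹ j<period)) returns

  orbit-injective : ∀ {i j} → i < period → j < period → iterate f x i ≡ iterate f x j → i ≡ j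
  orbit-injective {i} {j} i<period j<period eq with <-cmp i j
  ... | tri≈ _ i≡j _ = i≡j
  ... | tri< i<j _ _ = ⊥-elim (no-early-return i<j j<period eq)
  ... | tri> _ _ j<i = ⊥-elim (no-early-return j<i i<period (sym eq))

-- Graphs

Vertex Edge : Graph → Set
Vertex G = Fin (V G)
Edge G = Fin (E G)


next-cases : ∀ {n} (i : Fin (suc n)) →
  (toℕ i < n × toℕ (next i) ≡ suc (toℕ i)) ⊎ (toℕ i ≡ n × next i ≡ Fin.zero)
next-cases {n} i with toℕ i <? n
... | yes i<n = inj₁ (i<n , toℕ-fromℕ< (s≤s i<n))
... | no i≮n = inj₂ (≤-antisym (s≤s⁻¹ (toℕ<n i)) (≮⇒≥ i≮n) , refl)

next-injective : ∀ {n} → Injective _≡_ _≡_ (next {n})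
next-injective {_} {i} {j} eq with next-cases i | next-cases j
... | inj₁ (_ , i′) | inj₁ (_ , j′) =
  toℕ-injective (suc-injective (trans (sym i′) (trans (cong toℕ eq) j′)))
... | inj₂ (i≡n , _) | inj₂ (j≡n , _) = toℕ-injective (trans i≡n (sym j≡n))
... | inj₁ (_ , i′) | inj₂ (_ , j′) = ⊥-elim (0≢1+n (trans (sym (cong toℕ (trans eq j′))) i′))
... | inj₂ (_ , i′) | inj₁ (_ , j′) = ⊥-elim (0≢1+n (trans (sym (cong toℕ (trans (sym eq) i′))) j′))

≅-from-bijections : ∀ {G H} (f : Vertex H → Vertex G) (g : Edge H → Edge G) →
  Bijective _≡_ _≡_ f → Bijective _≡_ _≡_ g →
  (∀ i → Joins G (g i) (f (proj₁ (ends H i))) (f (proj₂ (ends H i)))) → G ≅ H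
≅-from-bijections {G} {H} f g f-bijective g-bijective joins = ↔-sym vertices , ↔-sym edges , joins⁻¹
  where
  vertices : Vertex H ↔ Vertex G
  vertices = ⤖⇒↔ (mk⤖ f-bijective)

  edges : Edge H ↔ Edge G
  edges = ⤖⇒↔ (mk⤖ g-bijective)

  joins⁻¹ : ∀ e → Joins H (Inverse.from edges e)
    (Inverse.from vertices (proj₁ (ends G e))) (Inverse.from vertices (proj₂ (ends G e)))
  joins⁻¹ e = Sum.map (sym ∘ cancel) (sym ∘ cong swap ∘ cancel)
                      (subst (λ d → Joins G d (f p) (f q)) (Inverse.strictlyInverseˡ edges e) (joins i))
    where
    i : Edge H
    i = Inverse.from edges e

    p q : Vertex H
    p = proj₁ (ends H i)
    q = proj₂ (ends H i)

    cancel : ∀ {p q} → ends G e ≡ (f p , f q) →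
      (Inverse.from vertices (proj₁ (ends G e)) , Inverse.from vertices (proj₂ (ends G e))) ≡ (p , q)
    cancel eq = cong₂ _,_ (trans (cong (Inverse.from vertices ∘ proj₁) eq) (Inverse.strictlyInverseʳ vertices _))
                          (trans (cong (Inverse.from vertices ∘ proj₂) eq) (Inverse.strictlyInverseʳ vertices _))

record Degree≥3 (G : Graph) : Set where
  field
    centre : Vertex G
    edge₁ edge₂ edge₃ : Edge G
    incident₁ : Incident G centre edge₁
    incident₂ : Incident G centre edge₂
    incident₃ : Incident G centre edge₃
    edge₁≢edge₂ : edge₁ ≢ edge₂
    edge₁≢edge₃ : edge₁ ≢ edge₃
    edge₂≢edge₃ : edge₂ ≢ edge₃

module _ (G : Graph) where

  private variable
    a b c y z : Vertex G
    e e₁ e₂ : Edge G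

  Joins-sym : Joins G e a b → Joins G e b a
  Joins-sym (inj₁ eq) = inj₂ eq
  Joins-sym (inj₂ eq) = inj₁ eq

  Joins⇒Incidentˡ : Joins G e a b → Incident G a e
  Joins⇒Incidentˡ (inj₁ eq) = inj₁ (cong proj₁ eq)
  Joins⇒Incidentˡ (inj₂ eq) = inj₂ (cong proj₂ eq)

  Joins⇒Incidentʳ : Joins G e a b → Incident G b e
  Joins⇒Incidentʳ = Joins⇒Incidentˡ ∘ Joins-sym

  Joins-ends : Joins G e a b → Incident G z e → z ≡ a ⊎ z ≡ b
  Joins-ends (inj₁ eq) (inj₁ refl) = inj₁ (cong proj₁ eq)
  Joins-ends (inj₁ eq) (inj₂ refl) = inj₂ (cong proj₂ eq)
  Joins-ends (inj₂ eq) (inj₁ refl) = inj₂ (cong proj₁ eq)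
  Joins-ends (inj₂ eq) (inj₂ refl) = inj₁ (cong proj₂ eq)

  otherEnd : Edge G → Vertex G → Vertex G
  otherEnd e z with proj₁ (ends G e) ≟ᶠ z
  ... | yes _ = proj₂ (ends G e)
  ... | no _ = proj₁ (ends G e)

  Incident⇒Joins-otherEnd : Incident G z e → Joins G e z (otherEnd e z)
  Incident⇒Joins-otherEnd {z} {e} z∈e with proj₁ (ends G e) ≟ᶠ z | z∈e
  ... | yes refl | _ = inj₁ refl
  ... | no z≢end | inj₁ z≡end = ⊥-elim (z≢end z≡end)
  ... | no _ | inj₂ refl = inj₂ refl

  otherEnd-involutive : Incident G z e → otherEnd e (otherEnd e z) ≡ z
  otherEnd-involutive {z} {e} z∈e with proj₁ (ends G e) ≟ᶠ z
  otherEnd-involutive {_} {e} _ | yes refl with proj₁ (ends G e) ≟ᶠ proj₂ (ends G e)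
  ... | yes p≡q = sym p≡q
  ... | no _ = refl
  otherEnd-involutive (inj₁ p≡z) | no p≢z = ⊥-elim (p≢z p≡z)
  otherEnd-involutive {_} {e} (inj₂ refl) | no _ with proj₁ (ends G e) ≟ᶠ proj₁ (ends G e)
  ... | yes _ = refl
  ... | no p≢p = ⊥-elim (p≢p refl)

  firstEdge : a ≢ b → (w : Walk G a b) → ∃[ e ] (Incident G a e × e ∈ walkEdges G w)
  firstEdge a≢a [] = ⊥-elim (a≢a refl)
  firstEdge _ (step e j _) = e , Joins⇒Incidentˡ j , here refl

  _▷_ : Walk G a b → Σ (Edge G) (λ e → Joins G e b c) → Walk G a c
  [] ▷ (e , j) = step e j []
  step e′ j′ w ▷ ej = step e′ j′ (w ▷ ej)

  reverse : Walk G a b → Walk G b a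
  reverse [] = []
  reverse (step e j w) = reverse w ▷ (e , Joins-sym j)

  walkVerts-▷ : (w : Walk G a b) (ej : Σ (Edge G) (λ e → Joins G e b c)) →
    walkVerts G (w ▷ ej) ≡ walkVerts G w ∷ʳ c
  walkVerts-▷ [] _ = refl
  walkVerts-▷ (step e j w) ej = cong (_ ∷_) (walkVerts-▷ w ej)

  walkEdges-▷ : (w : Walk G a b) (ej : Σ (Edge G) (λ e → Joins G e b c)) →
    walkEdges G (w ▷ ej) ≡ walkEdges G w ∷ʳ proj₁ ej
  walkEdges-▷ [] _ = refl
  walkEdges-▷ (step e j w) ej = cong (e ∷_) (walkEdges-▷ w ej)

  walkVerts-reverse : (w : Walk G a b) → walkVerts G (reverse w) ≡ List.reverse (walkVerts G w)
  walkVerts-reverse [] = refl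
  walkVerts-reverse {a} (step e j w) = begin
    walkVerts G (reverse w ▷ (e , Joins-sym j)) ≡⟨ walkVerts-▷ (reverse w) _ ⟩
    walkVerts G (reverse w) ∷ʳ a                 ≡⟨ cong (_∷ʳ a) (walkVerts-reverse w) ⟩
    List.reverse (walkVerts G w) ∷ʳ a            ≡⟨ unfold-reverse a (walkVerts G w) ⟨
    List.reverse (a ∷ walkVerts G w)             ∎
    where open ≡-Reasoning

  walkEdges-reverse : (w : Walk G a b) → walkEdges G (reverse w) ≡ List.reverse (walkEdges G w)
  walkEdges-reverse [] = refl
  walkEdges-reverse (step e j w) = begin
    walkEdges G (reverse w ▷ (e , Joins-sym j)) ≡⟨ walkEdges-▷ (reverse w) _ ⟩
    walkEdges G (reverse w) ∷ʳ e                 ≡⟨ cong (_∷ʳ e) (walkEdges-reverse w) ⟩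
    List.reverse (walkEdges G w) ∷ʳ e            ≡⟨ unfold-reverse e (walkEdges G w) ⟨
    List.reverse (e ∷ walkEdges G w)             ∎
    where open ≡-Reasoning

  walkVerts-subst : (eq : b ≡ c) (w : Walk G a b) → walkVerts G (subst (Walk G a) eq w) ≡ walkVerts G w
  walkVerts-subst refl w = refl

  walkEdges-subst : (eq : b ≡ c) (w : Walk G a b) → walkEdges G (subst (Walk G a) eq w) ≡ walkEdges G w
  walkEdges-subst refl w = refl

  ∈-reverse⁻ : (w : Walk G a b) → z ∈ walkVerts G (reverse w) → z ∈ walkVerts G w
  ∈-reverse⁻ w z∈ = Any.reverse⁻ (subst (_ ∈_) (walkVerts-reverse w) z∈)

  ∈-reverse⁺ : (w : Walk G a b) → z ∈ walkVerts G w → z ∈ walkVerts G (reverse w)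
  ∈-reverse⁺ w z∈ = subst (_ ∈_) (sym (walkVerts-reverse w)) (Any.reverse⁺ z∈)

  ∈-reverseEdges⁻ : (w : Walk G a b) → e ∈ walkEdges G (reverse w) → e ∈ walkEdges G w
  ∈-reverseEdges⁻ w e∈ = Any.reverse⁻ (subst (_ ∈_) (walkEdges-reverse w) e∈)

  reverse-IsPath : (w : Walk G a b) → IsPath G w → IsPath G (reverse w)
  reverse-IsPath w path = subst Unique (sym (walkVerts-reverse w)) (Unique-reverse path)

  reverse-edges-unique : (w : Walk G a b) → Unique (walkEdges G w) → Unique (walkEdges G (reverse w))
  reverse-edges-unique w unique = subst Unique (sym (walkEdges-reverse w)) (Unique-reverse unique)

  Incident? : ∀ z e → Dec (Incident G z e)
  Incident? z e = (proj₁ (ends G e) ≟ᶠ z) ⊎-dec (proj₂ (ends G e) ≟ᶠ z)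

  Connected-closed : Connected G → (P : Vertex G → Set) → (∀ {a b e} → P a → Joins G e a b → P b) →
    P a → ∀ b → P b
  Connected-closed {a} connected P closed Pa b = along (connected a b) Pa
    where
    along : ∀ {a b} → Walk G a b → P a → P b
    along [] Pa = Pa
    along (step e j w) Pa = along w (closed Pa j)

  theta⇒Degree≥3 : ThetaBisubdivision G → Degree≥3 G
  theta⇒Degree≥3 H = record
    { centre = u
    ; incident₁ = proj₁ (proj₂ first₁)
    ; incident₂ = proj₁ (proj₂ first₂)
    ; incident₃ = proj₁ (proj₂ first₃)
    ; edge₁≢edge₂ = Unique-++⇒≢ E₁ edgesDistinct (proj₂ (proj₂ first₁)) (∈-++⁺ˡ (proj₂ (proj₂ first₂)))
    ; edge₁≢edge₃ = Unique-++⇒≢ E₁ edgesDistinct (proj₂ (proj₂ first₁)) (∈-++⁺ʳ E₂ (proj₂ (proj₂ first₃)))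
    ; edge₂≢edge₃ = Unique-++⇒≢ E₂ (Unique-++⁻ʳ E₁ edgesDistinct)
                                (proj₂ (proj₂ first₂)) (proj₂ (proj₂ first₃))
    }
    where
    open ThetaBisubdivision H

    E₁ E₂ : List (Edge G)
    E₁ = walkEdges G P₁
    E₂ = walkEdges G P₂

    first₁ : ∃[ e ] (Incident G u e × e ∈ E₁)
    first₁ = firstEdge u≢v P₁

    first₂ : ∃[ e ] (Incident G u e × e ∈ E₂)
    first₂ = firstEdge u≢v P₂

    first₃ : ∃[ e ] (Incident G u e × e ∈ walkEdges G P₃)
    first₃ = firstEdge u≢v P₃

  ¬Degree≥3⇒ThetaFree : ¬ Degree≥3 G → ThetaFree G
  ¬Degree≥3⇒ThetaFree max2 H _ = max2 (theta⇒Degree≥3 H)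

  at-most-two : ¬ Degree≥3 G → Incident G z e → Incident G z e₁ → Incident G z e₂ → e₁ ≢ e₂ →
    e ≡ e₁ ⊎ e ≡ e₂
  at-most-two {z} {e} {e₁} {e₂} max2 z∈e z∈e₁ z∈e₂ e₁≢e₂ with e ≟ᶠ e₁ | e ≟ᶠ e₂
  ... | yes e≡e₁ | _ = inj₁ e≡e₁
  ... | no _ | yes e≡e₂ = inj₂ e≡e₂
  ... | no e≢e₁ | no e≢e₂ = ⊥-elim (max2 record
    { centre = z ; incident₁ = z∈e ; incident₂ = z∈e₁ ; incident₃ = z∈e₂
    ; edge₁≢edge₂ = e≢e₁ ; edge₁≢edge₃ = e≢e₂ ; edge₂≢edge₃ = e₁≢e₂ })

  record PerfectMatching : Set where
    field
      member : Edge G → Bool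
      perfect : IsPerfectMatching G member

    private
      cover : ∀ z → Σ (Edge G) λ e → (member e ≡ true) × Incident G z e ×
        (∀ e′ → member e′ ≡ true → Incident G z e′ → e′ ≡ e)
      cover z = proj₂ perfect z λ ()

    edgeAt : Vertex G → Edge G
    edgeAt z = proj₁ (cover z)

    edgeAt-member : ∀ z → member (edgeAt z) ≡ true
    edgeAt-member z = proj₁ (proj₂ (cover z))

    edgeAt-incident : ∀ z → Incident G z (edgeAt z)
    edgeAt-incident z = proj₁ (proj₂ (proj₂ (cover z)))

    edgeAt-unique : ∀ {z e} → member e ≡ true → Incident G z e → e ≡ edgeAt z
    edgeAt-unique {z} {e} = proj₂ (proj₂ (proj₂ (cover z))) e

    mate : Vertex G → Vertex G
    mate z = otherEnd (edgeAt z) z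

    mate-joins : ∀ z → Joins G (edgeAt z) z (mate z)
    mate-joins z = Incident⇒Joins-otherEnd (edgeAt-incident z)

    edgeAt-mate : ∀ z → edgeAt (mate z) ≡ edgeAt z
    edgeAt-mate z = sym (edgeAt-unique (edgeAt-member z) (Joins⇒Incidentʳ (mate-joins z)))

    mate-involutive : ∀ z → mate (mate z) ≡ z
    mate-involutive z = trans (cong (λ e → otherEnd e (mate z)) (edgeAt-mate z))
                              (otherEnd-involutive (edgeAt-incident z))

    mate-injective : Injective _≡_ _≡_ mate
    mate-injective {y} {z} eq = trans (sym (mate-involutive y)) (trans (cong mate eq) (mate-involutive z))

    matched-ends : ∀ {y z e} → member e ≡ true → Incident G y e → Incident G z e → z ≡ y ⊎ z ≡ mate y
    matched-ends m y∈e = Joins-ends (subst (λ e → Joins G e _ _) (sym (edgeAt-unique m y∈e)) (mate-joins _))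

  module _ (M : PerfectMatching) where
    open PerfectMatching M
    open DecMembership (_≟ᶠ_ {V G}) using (_∈?_)

    mate-closed⇒avoiding : (S : List (Vertex G)) → (∀ {z} → z ∈ S → mate z ∈ S) →
      ∃[ M′ ] PerfectMatchingAvoiding G S M′
    mate-closed⇒avoiding S closed = M′ , avoids , covers
      where
      Kept : Edge G → Set
      Kept e = member e ≡ true × proj₁ (ends G e) ∉ S

      kept? : ∀ e → Dec (Kept e)
      kept? e = member e ≟ᵇ true ×-dec ¬? (proj₁ (ends G e) ∈? S)

      M′ : Edge G → Bool
      M′ e = isYes (kept? e)

      avoids : ∀ e → M′ e ≡ true → ∀ y → Incident G y e → y ∉ S
      avoids e eq y y∈e y∈S with toWitness {a? = kept? e} (Equivalence.from T-≡ eq)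
      ... | m , first∉S with matched-ends m y∈e (inj₁ refl)
      ...   | inj₁ first≡y = first∉S (subst (_∈ S) (sym first≡y) y∈S)
      ...   | inj₂ first≡mate = first∉S (subst (_∈ S) (sym first≡mate) (closed y∈S))

      covers : ∀ y → y ∉ S → Σ (Edge G) λ e → (M′ e ≡ true) × Incident G y e ×
        (∀ e′ → M′ e′ ≡ true → Incident G y e′ → e′ ≡ e)
      covers y y∉S = edgeAt y
                   , Equivalence.to T-≡ (fromWitness (edgeAt-member y , first∉S))
                   , edgeAt-incident y
                   , λ e′ eq → edgeAt-unique (proj₁ (toWitness {a? = kept? e′} (Equivalence.from T-≡ eq)))
        where
        first∉S : proj₁ (ends G (edgeAt y)) ∉ S
        first∉S first∈S with matched-ends (edgeAt-member y) (edgeAt-incident y) (inj₁ refl)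
        ... | inj₁ first≡y = y∉S (subst (_∈ S) first≡y first∈S)
        ... | inj₂ first≡mate =
          y∉S (subst (_∈ S) (mate-involutive y) (closed (subst (_∈ S) first≡mate first∈S)))

  open PerfectMatching using (edgeAt; mate; mate-joins)

  module _ (mc : MatchingCovered G) where

    matchingThrough : Edge G → PerfectMatching
    matchingThrough e = record
      { member = proj₁ (proj₂ (proj₂ mc) e)
      ; perfect = proj₁ (proj₂ (proj₂ (proj₂ mc) e))
      }

    edgeAt-matchingThrough : Incident G z e → edgeAt (matchingThrough e) z ≡ e
    edgeAt-matchingThrough {e = e} z∈e =
      sym (PerfectMatching.edgeAt-unique (matchingThrough e) (proj₂ (proj₂ (proj₂ (proj₂ mc) e))) z∈e)

  module Trace (f : Vertex G → Vertex G) (ε : Vertex G → Edge G)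
               (f-joins : ∀ z → Joins G (ε z) z (f z)) where

    trace : ∀ z n → Walk G z (iterate f z n)
    trace z zero = []
    trace z (suc n) = step (ε z) (f-joins z) (trace (f z) n)

    walkVerts-trace : ∀ z n → walkVerts G (trace z n) ≡ applyUpTo (iterate f z) (suc n)
    walkVerts-trace z zero = refl
    walkVerts-trace z (suc n) = cong (z ∷_) (walkVerts-trace (f z) n)

    walkEdges-trace : ∀ z n → walkEdges G (trace z n) ≡ applyUpTo (ε ∘ iterate f z) n
    walkEdges-trace z zero = refl
    walkEdges-trace z (suc n) = cong (ε z ∷_) (walkEdges-trace (f z) n)

    length-trace : ∀ z n → length (walkEdges G (trace z n)) ≡ n
    length-trace z n = trans (cong length (walkEdges-trace z n)) (length-applyUpTo _ n)

    ∈-trace⁻ : ∀ {y z n} → y ∈ walkVerts G (trace z n) → ∃[ i ] (i ≤ n × y ≡ iterate f z i)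
    ∈-trace⁻ {z = z} {n} y∈ with ∈-applyUpTo⁻ (iterate f z) (subst (_ ∈_) (walkVerts-trace z n) y∈)
    ... | i , s≤s i≤n , y≡ = i , i≤n , y≡

    ∈-trace⁺ : ∀ {z i n} → i ≤ n → iterate f z i ∈ walkVerts G (trace z n)
    ∈-trace⁺ {z} {i} {n} i≤n =
      subst (_ ∈_) (sym (walkVerts-trace z n)) (∈-applyUpTo⁺ (iterate f z) (s≤s i≤n))

    ∈-traceEdges⁻ : ∀ {e z n} → e ∈ walkEdges G (trace z n) → ∃[ i ] (i < n × e ≡ ε (iterate f z i))
    ∈-traceEdges⁻ {z = z} {n} e∈ = ∈-applyUpTo⁻ (ε ∘ iterate f z) (subst (_ ∈_) (walkEdges-trace z n) e∈)

    trace-isPath : ∀ {z n} → (∀ {i j} → i < j → j ≤ n → iterate f z i ≢ iterate f z j) →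
      IsPath G (trace z n)
    trace-isPath {z} {n} distinct = subst Unique (sym (walkVerts-trace z n))
      (applyUpTo⁺₁ (iterate f z) (suc n) λ i<j j<1+n → distinct i<j (s≤s⁻¹ j<1+n))

    trace-edges-unique : ∀ {z n} → (∀ {i j} → i < j → j < n → ε (iterate f z i) ≢ ε (iterate f z j)) →
      Unique (walkEdges G (trace z n))
    trace-edges-unique {z} {n} distinct = subst Unique (sym (walkEdges-trace z n))
      (applyUpTo⁺₁ (ε ∘ iterate f z) n distinct)

  module _ (bip : Bipartite G) where

    colour : Vertex G → Bool
    colour = proj₁ bip

    Joins-colour : Joins G e a b → colour b ≡ not (colour a)
    Joins-colour {e} (inj₁ eq) =
      subst₂ (λ p q → colour q ≡ not (colour p)) (cong proj₁ eq) (cong proj₂ eq)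
             (¬-not (proj₂ bip e ∘ sym))
    Joins-colour {e} (inj₂ eq) =
      subst₂ (λ p q → colour p ≡ not (colour q)) (cong proj₁ eq) (cong proj₂ eq) (¬-not (proj₂ bip e))

    Incident-same-colour : Incident G y e → Incident G z e → colour y ≡ colour z → y ≡ z
    Incident-same-colour (inj₁ refl) (inj₁ refl) _ = refl
    Incident-same-colour {e = e} (inj₁ refl) (inj₂ refl) same = ⊥-elim (proj₂ bip e same)
    Incident-same-colour {e = e} (inj₂ refl) (inj₁ refl) same = ⊥-elim (proj₂ bip e (sym same))
    Incident-same-colour (inj₂ refl) (inj₂ refl) _ = refl

    walk-parity : (w : Walk G a b) →
      (colour a ≡ colour b → Even (length (walkEdges G w))) ×
      (colour a ≢ colour b → Odd G (length (walkEdges G w)))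
    walk-parity [] = (λ _ → 0 , refl) , (λ differ → ⊥-elim (differ refl))
    walk-parity {a} {b} (step e j w) = even , odd
      where
      flipped : colour _ ≡ not (colour a)
      flipped = Joins-colour j

      even : colour a ≡ colour b → Even (suc (length (walkEdges G w)))
      even same with proj₂ (walk-parity w) (λ eq → not-¬ refl (trans (sym eq) (trans flipped (cong not same))))
      ... | j , len≡ = suc j , trans (cong suc len≡) (sym (*-suc 2 j))

      odd : colour a ≢ colour b → Odd G (suc (length (walkEdges G w)))
      odd differ with proj₁ (walk-parity w) (trans flipped (sym (¬-not (differ ∘ sym))))
      ... | j , len≡ = j , cong suc len≡

    Joins-colour-≢ : Joins G e a b → colour a ≡ colour z → colour b ≢ colour z
    Joins-colour-≢ j same eq = not-¬ refl (trans (sym eq) (trans (Joins-colour j) (cong not same)))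

    Joins-colour-≡ : Joins G e a b → colour a ≢ colour z → colour b ≡ colour z
    Joins-colour-≡ j differ = trans (Joins-colour j) (sym (¬-not (differ ∘ sym)))

    -- The permutation alt follows N from the colour class of x and M from the other
    -- one, so the orbit of x is the M–N alternating cycle through x.
    module Alternating (M N : PerfectMatching) (x : Vertex G) where
      private
        module M = PerfectMatching M
        module N = PerfectMatching N

      matchingOf : Bool → PerfectMatching
      matchingOf c = if does (c ≟ᵇ colour x) then N else M

      matchingOf-≡ : ∀ {c} → c ≡ colour x → matchingOf c ≡ N
      matchingOf-≡ {c} same with c ≟ᵇ colour x
      ... | yes _ = refl
      ... | no differ = ⊥-elim (differ same)

      matchingOf-≢ : ∀ {c} → c ≢ colour x → matchingOf c ≡ M
      matchingOf-≢ {c} differ with c ≟ᵇ colour x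
      ... | yes same = ⊥-elim (differ same)
      ... | no _ = refl

      sameSide? : ∀ z → Dec (colour z ≡ colour x)
      sameSide? z = colour z ≟ᵇ colour x

      alt : Vertex G → Vertex G
      alt z = mate (matchingOf (colour z)) z

      altEdge : Vertex G → Edge G
      altEdge z = edgeAt (matchingOf (colour z)) z

      alt-joins : ∀ z → Joins G (altEdge z) z (alt z)
      alt-joins z = mate-joins (matchingOf (colour z)) z

      alt-N : colour z ≡ colour x → alt z ≡ N.mate z
      alt-N {z} same = cong (λ X → mate X z) (matchingOf-≡ same)

      alt-M : colour z ≢ colour x → alt z ≡ M.mate z
      alt-M {z} differ = cong (λ X → mate X z) (matchingOf-≢ differ)

      altEdge-N : colour z ≡ colour x → altEdge z ≡ N.edgeAt z
      altEdge-N {z} same = cong (λ X → edgeAt X z) (matchingOf-≡ same)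

      altEdge-M : colour z ≢ colour x → altEdge z ≡ M.edgeAt z
      altEdge-M {z} differ = cong (λ X → edgeAt X z) (matchingOf-≢ differ)

      alt-injective : Injective _≡_ _≡_ alt
      alt-injective {y} {z} eq = PerfectMatching.mate-injective (matchingOf (colour z))
        (subst (λ X → mate X y ≡ alt z) (cong matchingOf same-colour) eq)
        where
        same-colour : colour y ≡ colour z
        same-colour = not-injective (trans (sym (Joins-colour (alt-joins y)))
                                           (trans (cong colour eq) (Joins-colour (alt-joins z))))

      open Orbit alt alt-injective x public
      open Trace alt altEdge alt-joins public

      OnCycle : Vertex G → Set
      OnCycle z = ∃[ i ] (i < period × iterate alt x i ≡ z)

      OnCycle? : ∀ z → Dec (OnCycle z)
      OnCycle? z = anyUpTo? (λ i → iterate alt x i ≟ᶠ z) period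

      OnCycle-≤ : ∀ {i} → i ≤ period → OnCycle (iterate alt x i)
      OnCycle-≤ {i} i≤period with m≤n⇒m<n∨m≡n i≤period
      ... | inj₁ i<period = i , i<period , refl
      ... | inj₂ refl = 0 , z<s , sym iterate-period

      OnCycle-alt : OnCycle z → OnCycle (alt z)
      OnCycle-alt (i , i<period , refl) = subst OnCycle (iterate-suc alt x i) (OnCycle-≤ i<period)

      OnCycle-alt⁻¹ : OnCycle (alt y) → OnCycle y
      OnCycle-alt⁻¹ (zero , _ , x≡) =
        pred period , ≤-refl , alt-injective (trans (sym (iterate-suc alt x (pred period))) (trans iterate-period x≡))
      OnCycle-alt⁻¹ (suc i , i<period , eq) =
        i , <-trans (n<1+n i) i<period , alt-injective (trans (sym (iterate-suc alt x i)) eq)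

      OnCycle-M-mate : OnCycle z → OnCycle (M.mate z)
      OnCycle-M-mate {z} on with sameSide? z
      ... | no differ = subst OnCycle (alt-M differ) (OnCycle-alt on)
      ... | yes same = OnCycle-alt⁻¹ (subst OnCycle (sym back) on)
        where
        back : alt (M.mate z) ≡ z
        back = trans (alt-M (Joins-colour-≢ (M.mate-joins z) same)) (M.mate-involutive z)

      OnCycle-N-mate : OnCycle z → OnCycle (N.mate z)
      OnCycle-N-mate {z} on with sameSide? z
      ... | yes same = subst OnCycle (alt-N same) (OnCycle-alt on)
      ... | no differ = OnCycle-alt⁻¹ (subst OnCycle (sym back) on)
        where
        back : alt (N.mate z) ≡ z
        back = trans (alt-N (Joins-colour-≡ (N.mate-joins z) differ)) (N.mate-involutive z)

      Agree : Vertex G → Set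
      Agree z = M.edgeAt z ≡ N.edgeAt z

      Agree-mates : Agree z → M.mate z ≡ N.mate z
      Agree-mates {z} agree = cong (λ e → otherEnd e z) agree

      Agree-M-mate : Agree z → Agree (M.mate z)
      Agree-M-mate {z} agree = begin
        M.edgeAt (M.mate z) ≡⟨ M.edgeAt-mate z ⟩
        M.edgeAt z          ≡⟨ agree ⟩
        N.edgeAt z          ≡⟨ N.edgeAt-mate z ⟨
        N.edgeAt (N.mate z) ≡⟨ cong N.edgeAt (Agree-mates agree) ⟨
        N.edgeAt (M.mate z) ∎
        where open ≡-Reasoning

      Agree-alt : Agree z → Agree (alt z)
      Agree-alt {z} agree with sameSide? z
      ... | no _ = Agree-M-mate agree
      ... | yes _ = subst Agree (Agree-mates agree) (Agree-M-mate agree)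

      Agree-iterate : Agree z → ∀ n → Agree (iterate alt z n)
      Agree-iterate agree zero = agree
      Agree-iterate agree (suc n) = Agree-iterate (Agree-alt agree) n

      iterate-to-period : ∀ {i} → i ≤ period → iterate alt (iterate alt x i) (period ∸ i) ≡ x
      iterate-to-period {i} i≤period = begin
        iterate alt (iterate alt x i) (period ∸ i) ≡⟨ iterate-+ alt x i (period ∸ i) ⟨
        iterate alt x (i + (period ∸ i))           ≡⟨ cong (iterate alt x) (m+[n∸m]≡n i≤period) ⟩
        iterate alt x period                       ≡⟨ iterate-period ⟩
        x                                          ∎
        where open ≡-Reasoning

      OnCycle⇒¬Agree : ¬ Agree x → OnCycle z → ¬ Agree z
      OnCycle⇒¬Agree disagree (i , i<period , refl) agree =
        disagree (subst Agree (iterate-to-period (<⇒≤ i<period)) (Agree-iterate agree (period ∸ i)))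

      N-edge∈M⇒Agree : N.edgeAt y ≡ M.edgeAt z → Agree z
      N-edge∈M⇒Agree {y} {z} eq =
        N.edgeAt-unique (subst (λ e → N.member e ≡ true) eq (N.edgeAt-member y)) (M.edgeAt-incident z)

      altEdge-injective : ¬ Agree x → OnCycle y → OnCycle z → altEdge y ≡ altEdge z → y ≡ z
      altEdge-injective {y} {z} disagree on-y on-z eq with sameSide? y | sameSide? z
      ... | yes y-side | yes z-side =
        Incident-same-colour (N.edgeAt-incident y) (subst (Incident G z) (sym eq) (N.edgeAt-incident z))
                             (trans y-side (sym z-side))
      ... | no y-side | no z-side =
        Incident-same-colour (M.edgeAt-incident y) (subst (Incident G z) (sym eq) (M.edgeAt-incident z))
                             (trans (¬-not y-side) (sym (¬-not z-side)))
      ... | yes _ | no _ = ⊥-elim (OnCycle⇒¬Agree disagree on-z (N-edge∈M⇒Agree eq))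
      ... | no _ | yes _ = ⊥-elim (OnCycle⇒¬Agree disagree on-y (N-edge∈M⇒Agree (sym eq)))

      altEdge-ends : Incident G z (altEdge y) → z ≡ y ⊎ z ≡ alt y
      altEdge-ends = Joins-ends (alt-joins _)

      altEdge-at : Incident G z (altEdge y) → altEdge y ≡ M.edgeAt z ⊎ altEdge y ≡ N.edgeAt z
      altEdge-at {z} {y} z∈e with sameSide? y
      ... | yes _ = inj₂ (N.edgeAt-unique (N.edgeAt-member y) z∈e)
      ... | no _ = inj₁ (M.edgeAt-unique (M.edgeAt-member y) z∈e)

      M-mate-forward : ∀ k → colour (iterate alt x k) ≢ colour x →
        M.mate (iterate alt x k) ≡ iterate alt x (suc k)
      M-mate-forward k differ = trans (sym (alt-M differ)) (sym (iterate-suc alt x k))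

      M-mate-backward : ∀ k → colour (iterate alt x (suc k)) ≡ colour x →
        M.mate (iterate alt x (suc k)) ≡ iterate alt x k
      M-mate-backward k same = begin
        M.mate (iterate alt x (suc k))        ≡⟨ cong M.mate (iterate-suc alt x k) ⟩
        M.mate (alt (iterate alt x k))        ≡⟨ cong M.mate (alt-M previous-side) ⟩
        M.mate (M.mate (iterate alt x k))     ≡⟨ M.mate-involutive _ ⟩
        iterate alt x k                       ∎
        where
        open ≡-Reasoning
        previous-side : colour (iterate alt x k) ≢ colour x
        previous-side same′ =
          Joins-colour-≢ (alt-joins _) same′ (subst (λ v → colour v ≡ colour x) (iterate-suc alt x k) same)

    module ThetaFromMatchings (M N₂ N₃ : PerfectMatching) (x : Vertex G)
      (M≢N₂ : edgeAt M x ≢ edgeAt N₂ x) (M≢N₃ : edgeAt M x ≢ edgeAt N₃ x)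
      (N₂≢N₃ : edgeAt N₂ x ≢ edgeAt N₃ x) where
      private
        module M = PerfectMatching M
        module C = Alternating M N₂ x
        module Q = Alternating M N₃ x

      γ δ : ℕ → Vertex G
      γ = iterate C.alt x
      δ = iterate Q.alt x

      x-on-C : C.OnCycle x
      x-on-C = 0 , z<s , refl

      private
        opaque
          first-return : ∃[ s ] (C.OnCycle (δ (suc s)) × ∀ {i} → i < s → ¬ C.OnCycle (δ (suc i)))
          first-return = least (λ s → C.OnCycle? (δ (suc s))) {pred Q.period}
                               (subst C.OnCycle (sym Q.iterate-period) x-on-C)

      s : ℕ
      s = proj₁ first-return

      returns-to-C : C.OnCycle (δ (suc s))
      returns-to-C = proj₁ (proj₂ first-return)

      avoids-C : ∀ {i} → i < s → ¬ C.OnCycle (δ (suc i))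
      avoids-C = proj₂ (proj₂ first-return)

      ℓ : ℕ
      ℓ = proj₁ returns-to-C

      ℓ<period : ℓ < C.period
      ℓ<period = proj₁ (proj₂ returns-to-C)

      w : Vertex G
      w = γ ℓ

      w≡ : w ≡ δ (suc s)
      w≡ = proj₂ (proj₂ returns-to-C)

      -- C is closed under M, and Q reaches the colour class of x only along M-edges,
      -- so Q can only first return to C in the other colour class.
      first-return-colour : ∀ k → (∀ {i} → i < k → ¬ C.OnCycle (δ (suc i))) → C.OnCycle (δ (suc k)) →
        colour (δ (suc k)) ≢ colour x
      first-return-colour zero _ _ same = Joins-colour-≢ (Q.alt-joins x) refl same
      first-return-colour (suc k) avoids on same =
        avoids (n<1+n k) (subst C.OnCycle (Q.M-mate-backward (suc k) same) (C.OnCycle-M-mate on))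

      x-w-colour : colour x ≢ colour w
      x-w-colour eq = first-return-colour s avoids-C returns-to-C (trans (cong colour (sym w≡)) (sym eq))

      x≢w : x ≢ w
      x≢w = x-w-colour ∘ cong colour

      0<ℓ : 0 < ℓ
      0<ℓ = n≢0⇒n>0 λ ℓ≡0 → x≢w (sym (cong γ ℓ≡0))

      s<last : s < pred Q.period
      s<last with <-cmp s (pred Q.period)
      ... | tri< s<last _ _ = s<last
      ... | tri≈ _ s≡last _ =
        ⊥-elim (x≢w (trans (sym Q.iterate-period) (trans (cong (δ ∘ suc) (sym s≡last)) (sym w≡))))
      ... | tri> _ _ last<s = ⊥-elim (avoids-C last<s (subst C.OnCycle (sym Q.iterate-period) x-on-C))

      ℓ+≤period : ∀ {j} → j ≤ C.period ∸ ℓ → ℓ + j ≤ C.period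
      ℓ+≤period j≤ = ≤-trans (+-monoʳ-≤ ℓ j≤) (≤-reflexive (m+[n∸m]≡n (<⇒≤ ℓ<period)))

      ℓ+<period : ∀ {j} → j < C.period ∸ ℓ → ℓ + j < C.period
      ℓ+<period {j} j< = subst (_≤ C.period) (+-suc ℓ j) (ℓ+≤period j<)

      C-from-w : Walk G w (iterate C.alt w (C.period ∸ ℓ))
      C-from-w = C.trace w (C.period ∸ ℓ)

      C-back-to-x : iterate C.alt w (C.period ∸ ℓ) ≡ x
      C-back-to-x = C.iterate-to-period (<⇒≤ ℓ<period)

      P₁ P₂ P₃ : Walk G x w
      P₁ = C.trace x ℓ
      P₂ = reverse (subst (Walk G w) C-back-to-x C-from-w)
      P₃ = subst (Walk G x) (sym w≡) (Q.trace x (suc s))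

      ∈P₁⁻ : z ∈ walkVerts G P₁ → ∃[ i ] (i ≤ ℓ × z ≡ γ i)
      ∈P₁⁻ = C.∈-trace⁻

      ∈P₂⁻ : z ∈ walkVerts G P₂ → ∃[ j ] (j ≤ C.period ∸ ℓ × z ≡ γ (ℓ + j))
      ∈P₂⁻ {z} z∈ =
        let j , j≤ , z≡ = C.∈-trace⁻ {z} {w} {C.period ∸ ℓ}
                            (subst (z ∈_) (walkVerts-subst C-back-to-x C-from-w)
                                   (∈-reverse⁻ (subst (Walk G w) C-back-to-x C-from-w) z∈))
        in j , j≤ , trans z≡ (sym (iterate-+ C.alt x ℓ j))

      ∈P₂⁺ : ∀ {j} → j ≤ C.period ∸ ℓ → γ (ℓ + j) ∈ walkVerts G P₂
      ∈P₂⁺ {j} j≤ =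
        ∈-reverse⁺ (subst (Walk G w) C-back-to-x C-from-w)
          (subst (γ (ℓ + j) ∈_) (sym (walkVerts-subst C-back-to-x C-from-w))
            (subst (_∈ walkVerts G C-from-w) (sym (iterate-+ C.alt x ℓ j)) (C.∈-trace⁺ j≤)))

      γ∈P₂ : ∀ {i} → ℓ ≤ i → i ≤ C.period → γ i ∈ walkVerts G P₂
      γ∈P₂ {i} ℓ≤i i≤period =
        subst (_∈ walkVerts G P₂) (cong γ (m+[n∸m]≡n ℓ≤i)) (∈P₂⁺ (∸-monoˡ-≤ ℓ i≤period))

      ∈P₃⁻ : z ∈ walkVerts G P₃ → ∃[ k ] (k ≤ suc s × z ≡ δ k)
      ∈P₃⁻ z∈ = Q.∈-trace⁻ (subst (_ ∈_) (walkVerts-subst (sym w≡) (Q.trace x (suc s))) z∈)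

      ∈P₃⁺ : ∀ {k} → k ≤ suc s → δ k ∈ walkVerts G P₃
      ∈P₃⁺ k≤ = subst (_ ∈_) (sym (walkVerts-subst (sym w≡) (Q.trace x (suc s)))) (Q.∈-trace⁺ k≤)

      ∈E₁⁻ : e ∈ walkEdges G P₁ → ∃[ i ] (i < ℓ × e ≡ C.altEdge (γ i))
      ∈E₁⁻ = C.∈-traceEdges⁻

      ∈E₂⁻ : e ∈ walkEdges G P₂ → ∃[ j ] (j < C.period ∸ ℓ × e ≡ C.altEdge (γ (ℓ + j)))
      ∈E₂⁻ {e} e∈ =
        let j , j< , e≡ = C.∈-traceEdges⁻ {e} {w} {C.period ∸ ℓ}
                            (subst (e ∈_) (walkEdges-subst C-back-to-x C-from-w)
                                   (∈-reverseEdges⁻ (subst (Walk G w) C-back-to-x C-from-w) e∈))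
        in j , j< , trans e≡ (cong C.altEdge (sym (iterate-+ C.alt x ℓ j)))

      ∈E₃⁻ : e ∈ walkEdges G P₃ → ∃[ k ] (k < suc s × e ≡ Q.altEdge (δ k))
      ∈E₃⁻ e∈ = Q.∈-traceEdges⁻ (subst (_ ∈_) (walkEdges-subst (sym w≡) (Q.trace x (suc s))) e∈)

      γ-injective : ∀ {i j} → i < C.period → j < C.period → γ i ≡ γ j → i ≡ j
      γ-injective = C.orbit-injective

      γ-edge-injective : ∀ {i j} → i < C.period → j < C.period →
        C.altEdge (γ i) ≡ C.altEdge (γ j) → i ≡ j
      γ-edge-injective i< j< eq = γ-injective i< j< (C.altEdge-injective M≢N₂ (_ , i< , refl) (_ , j< , refl) eq)

      δ-edge-injective : ∀ {i j} → i < Q.period → j < Q.period →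
        Q.altEdge (δ i) ≡ Q.altEdge (δ j) → i ≡ j
      δ-edge-injective i< j< eq =
        Q.orbit-injective i< j< (Q.altEdge-injective M≢N₃ (_ , i< , refl) (_ , j< , refl) eq)

      δ-bound : ∀ {k} → k ≤ suc s → k < Q.period
      δ-bound k≤ = ≤-<-trans k≤ (s≤s s<last)

      on-C⇒ends : C.OnCycle z → z ∈ walkVerts G P₃ → z ≡ x ⊎ z ≡ w
      on-C⇒ends on z∈ with ∈P₃⁻ z∈
      ... | zero , _ , z≡ = inj₁ z≡
      ... | suc k , k≤ , z≡ with m≤n⇒m<n∨m≡n (s≤s⁻¹ k≤)
      ...   | inj₁ k<s = ⊥-elim (avoids-C k<s (subst C.OnCycle z≡ on))
      ...   | inj₂ refl = inj₂ (trans z≡ (sym w≡))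

      P₁-on-C : z ∈ walkVerts G P₁ → C.OnCycle z
      P₁-on-C z∈ = let i , i≤ℓ , z≡ = ∈P₁⁻ z∈ in
        subst C.OnCycle (sym z≡) (C.OnCycle-≤ (≤-trans i≤ℓ (<⇒≤ ℓ<period)))

      P₂-on-C : z ∈ walkVerts G P₂ → C.OnCycle z
      P₂-on-C z∈ = let j , j≤ , z≡ = ∈P₂⁻ z∈ in
        subst C.OnCycle (sym z≡) (C.OnCycle-≤ (ℓ+≤period j≤))

      disjoint₁₂ : ∀ z → z ∈ walkVerts G P₁ → z ∈ walkVerts G P₂ → z ≡ x ⊎ z ≡ w
      disjoint₁₂ z z∈₁ z∈₂ =
        let i , i≤ℓ , z≡γi = ∈P₁⁻ z∈₁
            j , j≤ , z≡γℓ+j = ∈P₂⁻ z∈₂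
        in [ (λ ℓ+j<period → inj₂ (trans z≡γi (cong γ (≤-antisym i≤ℓ
                 (subst (ℓ ≤_) (sym (γ-injective (≤-<-trans i≤ℓ ℓ<period) ℓ+j<period
                                                  (trans (sym z≡γi) z≡γℓ+j))) (m≤m+n ℓ j))))))
           , (λ ℓ+j≡period → inj₁ (trans z≡γℓ+j (trans (cong γ ℓ+j≡period) C.iterate-period)))
           ]′ (m≤n⇒m<n∨m≡n (ℓ+≤period j≤))

      path₁ : IsPath G P₁
      path₁ = C.trace-isPath λ i<j j≤ℓ eq →
        let j<period = ≤-<-trans j≤ℓ ℓ<period in
        <-irrefl (γ-injective (<-trans i<j j<period) j<period eq) i<j

      C-from-w-distinct : ∀ {i j} → i < j → j ≤ C.period ∸ ℓ → iterate C.alt w i ≢ iterate C.alt w j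
      C-from-w-distinct {i} {j} i<j j≤ eq = [ before-x , at-x ]′ (m≤n⇒m<n∨m≡n (ℓ+≤period j≤))
        where
        eq′ : γ (ℓ + i) ≡ γ (ℓ + j)
        eq′ = trans (iterate-+ C.alt x ℓ i) (trans eq (sym (iterate-+ C.alt x ℓ j)))

        ℓ+i<ℓ+j : ℓ + i < ℓ + j
        ℓ+i<ℓ+j = +-monoʳ-< ℓ i<j

        before-x : ℓ + j < C.period → ⊥
        before-x ℓ+j<period = <-irrefl (γ-injective (<-trans ℓ+i<ℓ+j ℓ+j<period) ℓ+j<period eq′) ℓ+i<ℓ+j

        at-x : ℓ + j ≡ C.period → ⊥
        at-x ℓ+j≡period = <-irrefl (sym ℓ+i≡0) (<-≤-trans 0<ℓ (m≤m+n ℓ i))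
          where
          ℓ+i≡0 : ℓ + i ≡ 0
          ℓ+i≡0 = γ-injective (<-≤-trans ℓ+i<ℓ+j (≤-reflexive ℓ+j≡period)) z<s
                    (trans eq′ (trans (cong γ ℓ+j≡period) C.iterate-period))

      path₂ : IsPath G P₂
      path₂ = reverse-IsPath (subst (Walk G w) C-back-to-x C-from-w)
        (subst Unique (sym (walkVerts-subst C-back-to-x C-from-w)) (C.trace-isPath C-from-w-distinct))

      path₃ : IsPath G P₃
      path₃ = subst Unique (sym (walkVerts-subst (sym w≡) (Q.trace x (suc s))))
        (Q.trace-isPath λ i<j j≤ eq →
          <-irrefl (Q.orbit-injective (δ-bound (<⇒≤ (<-≤-trans i<j j≤))) (δ-bound j≤) eq) i<j)

      unique₁ : Unique (walkEdges G P₁)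
      unique₁ = C.trace-edges-unique λ i<j j<ℓ eq →
        let j<period = <-trans j<ℓ ℓ<period in
        <-irrefl (γ-edge-injective (<-trans i<j j<period) j<period eq) i<j

      unique₂ : Unique (walkEdges G P₂)
      unique₂ = reverse-edges-unique (subst (Walk G w) C-back-to-x C-from-w)
        (subst Unique (sym (walkEdges-subst C-back-to-x C-from-w)) (C.trace-edges-unique distinct))
        where
        distinct : ∀ {i j} → i < j → j < C.period ∸ ℓ →
          C.altEdge (iterate C.alt w i) ≢ C.altEdge (iterate C.alt w j)
        distinct {i} {j} i<j j< eq =
          <-irrefl (+-cancelˡ-≡ ℓ i j (γ-edge-injective (ℓ+<period (<-trans i<j j<)) (ℓ+<period j<) eq′)) i<j
          where
          eq′ : C.altEdge (γ (ℓ + i)) ≡ C.altEdge (γ (ℓ + j))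
          eq′ = trans (cong C.altEdge (iterate-+ C.alt x ℓ i))
                      (trans eq (cong C.altEdge (sym (iterate-+ C.alt x ℓ j))))

      unique₃ : Unique (walkEdges G P₃)
      unique₃ = subst Unique (sym (walkEdges-subst (sym w≡) (Q.trace x (suc s))))
        (Q.trace-edges-unique λ i<j j< eq →
          <-irrefl (δ-edge-injective (δ-bound (<⇒≤ (<-trans i<j j<))) (δ-bound (<⇒≤ j<)) eq) i<j)

      E₁-on-C : e ∈ walkEdges G P₁ → ∃[ y ] (C.OnCycle y × e ≡ C.altEdge y)
      E₁-on-C e∈ = let i , i<ℓ , e≡ = ∈E₁⁻ e∈ in γ i , (i , <-trans i<ℓ ℓ<period , refl) , e≡

      E₂-on-C : e ∈ walkEdges G P₂ → ∃[ y ] (C.OnCycle y × e ≡ C.altEdge y)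
      E₂-on-C e∈ = let j , j< , e≡ = ∈E₂⁻ e∈ in γ (ℓ + j) , (ℓ + j , ℓ+<period j< , refl) , e≡

      Q-edge∉C : ∀ {k y} → k ≤ s → C.OnCycle y → Q.altEdge (δ k) ≢ C.altEdge y
      Q-edge∉C {zero} {y} _ _ eq = [ M≢N₃ ∘ sym ∘ via , N₂≢N₃ ∘ sym ∘ via ]′ (C.altEdge-at x∈)
        where
        x∈ : Incident G x (C.altEdge y)
        x∈ = subst (Incident G x) eq (Joins⇒Incidentˡ (Q.alt-joins x))
        via : ∀ {e′} → C.altEdge y ≡ e′ → edgeAt N₃ x ≡ e′
        via = trans (trans (sym (Q.altEdge-N refl)) eq)
      Q-edge∉C {suc k} {y} k<s on eq = avoids-C k<s
        ([ (λ δ≡y → subst C.OnCycle (sym δ≡y) on)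
         , (λ δ≡alt → subst C.OnCycle (sym δ≡alt) (C.OnCycle-alt on)) ]′
           (C.altEdge-ends (subst (Incident G _) eq (Joins⇒Incidentˡ (Q.alt-joins (δ (suc k)))))))

      E₃-off-C : e ∈ walkEdges G P₃ → ∀ {y} → C.OnCycle y → e ≢ C.altEdge y
      E₃-off-C e∈ on e≡ =
        let k , k<1+s , e≡δ = ∈E₃⁻ e∈ in Q-edge∉C (s≤s⁻¹ k<1+s) on (trans (sym e≡δ) e≡)

      disjoint-edges₁₂ : Disjoint (walkEdges G P₁) (walkEdges G P₂)
      disjoint-edges₁₂ (e∈₁ , e∈₂) =
        let i , i<ℓ , e≡₁ = ∈E₁⁻ e∈₁
            j , j< , e≡₂ = ∈E₂⁻ e∈₂
        in <-irrefl (γ-edge-injective (<-trans i<ℓ ℓ<period) (ℓ+<period j<) (trans (sym e≡₁) e≡₂))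
                    (<-≤-trans i<ℓ (m≤m+n ℓ j))

      disjoint-edges₂₃ : Disjoint (walkEdges G P₂) (walkEdges G P₃)
      disjoint-edges₂₃ (e∈₂ , e∈₃) = let y , on , e≡ = E₂-on-C e∈₂ in E₃-off-C e∈₃ on e≡

      disjoint-edges₁,₂₃ : Disjoint (walkEdges G P₁) (walkEdges G P₂ ++ walkEdges G P₃)
      disjoint-edges₁,₂₃ (e∈₁ , e∈₂₃) =
        [ (λ e∈₂ → disjoint-edges₁₂ (e∈₁ , e∈₂))
        , (λ e∈₃ → let y , on , e≡ = E₁-on-C e∈₁ in E₃-off-C e∈₃ on e≡)
        ]′ (∈-++⁻ (walkEdges G P₂) e∈₂₃)

      theta : ThetaBisubdivision G
      theta = record
        { u = x ; v = w ; u≢v = x≢w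
        ; P₁ = P₁ ; P₂ = P₂ ; P₃ = P₃
        ; path₁ = path₁ ; path₂ = path₂ ; path₃ = path₃
        ; odd₁ = proj₂ (walk-parity P₁) x-w-colour
        ; odd₂ = proj₂ (walk-parity P₂) x-w-colour
        ; odd₃ = proj₂ (walk-parity P₃) x-w-colour
        ; disj₁₂ = disjoint₁₂
        ; disj₁₃ = λ z z∈₁ z∈₃ → on-C⇒ends (P₁-on-C z∈₁) z∈₃
        ; disj₂₃ = λ z z∈₂ z∈₃ → on-C⇒ends (P₂-on-C z∈₂) z∈₃
        ; edgesDistinct = ++⁺ unique₁ (++⁺ unique₂ unique₃ disjoint-edges₂₃) disjoint-edges₁,₂₃
        }

      θ-vertices : List (Vertex G)
      θ-vertices = walkVerts G P₁ ++ walkVerts G P₂ ++ walkVerts G P₃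

      InTheta : Vertex G → Set
      InTheta z = C.OnCycle z ⊎ ∃[ k ] (k ≤ suc s × z ≡ δ k)

      ∈vertices⇒InTheta : z ∈ θ-vertices → InTheta z
      ∈vertices⇒InTheta z∈ =
        [ inj₁ ∘ P₁-on-C
        , [ inj₁ ∘ P₂-on-C , inj₂ ∘ ∈P₃⁻ ]′ ∘ ∈-++⁻ (walkVerts G P₂)
        ]′ (∈-++⁻ (walkVerts G P₁) z∈)

      InTheta⇒∈vertices : InTheta z → z ∈ θ-vertices
      InTheta⇒∈vertices (inj₂ (k , k≤ , z≡)) =
        ∈-++⁺ʳ (walkVerts G P₁)
          (∈-++⁺ʳ (walkVerts G P₂) (subst (_∈ walkVerts G P₃) (sym z≡) (∈P₃⁺ k≤)))
      InTheta⇒∈vertices (inj₁ (i , i<period , γi≡z)) =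
        [ (λ i≤ℓ → ∈-++⁺ˡ (subst (_∈ walkVerts G P₁) γi≡z (C.∈-trace⁺ i≤ℓ)))
        , (λ ℓ≤i → ∈-++⁺ʳ (walkVerts G P₁) (∈-++⁺ˡ {ys = walkVerts G P₃}
            (subst (_∈ walkVerts G P₂) γi≡z (γ∈P₂ ℓ≤i (<⇒≤ i<period)))))
        ]′ (≤-total i ℓ)

      δ-M-mate : ∀ k → k ≤ suc s → InTheta (M.mate (δ k))
      δ-M-mate k k≤ with colour (δ k) ≟ᵇ colour x
      δ-M-mate k k≤ | no differ =
        [ (λ k<1+s → inj₂ (suc k , k<1+s , Q.M-mate-forward k differ))
        , (λ k≡ → inj₁ (C.OnCycle-M-mate (subst C.OnCycle (cong δ (sym k≡)) returns-to-C)))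
        ]′ (m≤n⇒m<n∨m≡n k≤)
      δ-M-mate zero _ | yes _ = inj₁ (C.OnCycle-M-mate x-on-C)
      δ-M-mate (suc k) k≤ | yes same = inj₂ (k , ≤-trans (n≤1+n k) k≤ , Q.M-mate-backward k same)

      InTheta-M-mate : InTheta z → InTheta (M.mate z)
      InTheta-M-mate (inj₁ on) = inj₁ (C.OnCycle-M-mate on)
      InTheta-M-mate (inj₂ (k , k≤ , z≡)) = subst (InTheta ∘ M.mate) (sym z≡) (δ-M-mate k k≤)

      conformal : Conformal G theta
      conformal = mate-closed⇒avoiding M θ-vertices
        (InTheta⇒∈vertices ∘ InTheta-M-mate ∘ ∈vertices⇒InTheta)

    Degree≥3⇒¬ThetaFree : MatchingCovered G → Degree≥3 G → ¬ ThetaFree G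
    Degree≥3⇒¬ThetaFree mc d θ-free = θ-free T.theta T.conformal
      where
      open Degree≥3 d

      differ-at-centre : ∀ {e e′} → Incident G centre e → Incident G centre e′ → e ≢ e′ →
        edgeAt (matchingThrough mc e) centre ≢ edgeAt (matchingThrough mc e′) centre
      differ-at-centre centre∈e centre∈e′ e≢e′ eq =
        e≢e′ (trans (sym (edgeAt-matchingThrough mc centre∈e))
                    (trans eq (edgeAt-matchingThrough mc centre∈e′)))

      module T = ThetaFromMatchings
        (matchingThrough mc edge₁) (matchingThrough mc edge₂) (matchingThrough mc edge₃) centre
        (differ-at-centre incident₁ incident₂ edge₁≢edge₂)
        (differ-at-centre incident₁ incident₃ edge₁≢edge₃)
        (differ-at-centre incident₂ incident₃ edge₂≢edge₃)

    module MaxDegreeTwo (mc : MatchingCovered G) (max2 : ¬ Degree≥3 G) where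

      module SpanningCycle (x : Vertex G) (e₀ e₁ : Edge G)
        (x∈e₀ : Incident G x e₀) (x∈e₁ : Incident G x e₁) (e₀≢e₁ : e₀ ≢ e₁) where
        private
          M N : PerfectMatching
          M = matchingThrough mc e₀
          N = matchingThrough mc e₁
          module M = PerfectMatching M
          module N = PerfectMatching N
        open Alternating M N x

        disagree : ¬ Agree x
        disagree agree =
          e₀≢e₁ (trans (sym (edgeAt-matchingThrough mc x∈e₀))
                       (trans agree (edgeAt-matchingThrough mc x∈e₁)))

        edge-at-cycle : OnCycle z → Incident G z e → e ≡ M.edgeAt z ⊎ e ≡ N.edgeAt z
        edge-at-cycle {z} on z∈e =
          at-most-two max2 z∈e (M.edgeAt-incident z) (N.edgeAt-incident z) (OnCycle⇒¬Agree disagree on)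

        OnCycle-step : OnCycle a → Joins G e a b → OnCycle b
        OnCycle-step {a} on j with edge-at-cycle on (Joins⇒Incidentˡ j)
        ... | inj₁ refl =
          [ (λ b≡a → subst OnCycle (sym b≡a) on) , (λ b≡mate → subst OnCycle (sym b≡mate) (OnCycle-M-mate on)) ]′
            (Joins-ends (M.mate-joins a) (Joins⇒Incidentʳ j))
        ... | inj₂ refl =
          [ (λ b≡a → subst OnCycle (sym b≡a) on) , (λ b≡mate → subst OnCycle (sym b≡mate) (OnCycle-N-mate on)) ]′
            (Joins-ends (N.mate-joins a) (Joins⇒Incidentʳ j))

        opaque
          all-on-cycle : ∀ z → OnCycle z
          all-on-cycle = Connected-closed (proj₁ mc) OnCycle OnCycle-step (0 , z<s , refl)

        M-edge-is-altEdge : ∀ z → ∃[ y ] (altEdge y ≡ M.edgeAt z)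
        M-edge-is-altEdge z with sameSide? z
        ... | no differ = z , altEdge-M differ
        ... | yes same = M.mate z , trans (altEdge-M (Joins-colour-≢ (M.mate-joins z) same)) (M.edgeAt-mate z)

        N-edge-is-altEdge : ∀ z → ∃[ y ] (altEdge y ≡ N.edgeAt z)
        N-edge-is-altEdge z with sameSide? z
        ... | yes same = z , altEdge-N same
        ... | no differ = N.mate z , trans (altEdge-N (Joins-colour-≡ (N.mate-joins z) differ)) (N.edgeAt-mate z)

        every-edge-is-altEdge : ∀ e → ∃[ y ] (altEdge y ≡ e)
        every-edge-is-altEdge e =
          [ (λ e≡ → Product.map₂ (λ eq → trans eq (sym e≡)) (M-edge-is-altEdge first))
          , (λ e≡ → Product.map₂ (λ eq → trans eq (sym e≡)) (N-edge-is-altEdge first))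
          ]′ (edge-at-cycle (all-on-cycle first) (inj₁ refl))
          where
          first : Vertex G
          first = proj₁ (ends G e)

        opaque
          period-even : Even period
          period-even = subst Even (length-trace x period)
            (proj₁ (walk-parity (trace x period)) (cong colour (sym iterate-period)))

        module _ {n} (period≡ : period ≡ suc n) where
          cycleVertex : Fin (suc n) → Vertex G
          cycleVertex i = iterate alt x (toℕ i)

          cycleEdge : Fin (suc n) → Edge G
          cycleEdge i = altEdge (cycleVertex i)

          bounded : ∀ i → toℕ i < period
          bounded i = subst (toℕ i <_) (sym period≡) (toℕ<n i)

          cycleVertex-injective : Injective _≡_ _≡_ cycleVertex
          cycleVertex-injective eq = toℕ-injective (orbit-injective (bounded _) (bounded _) eq)

          index : OnCycle z → ∃[ i ] (cycleVertex i ≡ z)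
          index (i , i<period , eq) = fromℕ< i<1+n , trans (cong (iterate alt x) (toℕ-fromℕ< i<1+n)) eq
            where
            i<1+n : i < suc n
            i<1+n = subst (i <_) period≡ i<period

          cycleVertex-surjective : Surjective _≡_ _≡_ cycleVertex
          cycleVertex-surjective z = let i , eq = index (all-on-cycle z) in i , λ { refl → eq }

          cycleEdge-injective : Injective _≡_ _≡_ cycleEdge
          cycleEdge-injective eq = cycleVertex-injective (altEdge-injective disagree (all-on-cycle _) (all-on-cycle _) eq)

          cycleEdge-surjective : Surjective _≡_ _≡_ cycleEdge
          cycleEdge-surjective e =
            let y , altEdge≡ = every-edge-is-altEdge e
                i , cycleVertex≡ = index (all-on-cycle y)
            in i , λ { refl → trans (cong altEdge cycleVertex≡) altEdge≡ }

          cycleVertex-next : ∀ i → cycleVertex (next i) ≡ alt (cycleVertex i)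
          cycleVertex-next i with next-cases i
          ... | inj₁ (_ , toℕ-next) = trans (cong (iterate alt x) toℕ-next) (iterate-suc alt x (toℕ i))
          ... | inj₂ (i≡n , next≡0) = begin
            cycleVertex (next i)         ≡⟨ cong cycleVertex next≡0 ⟩
            x                         ≡⟨ iterate-period ⟨
            iterate alt x period      ≡⟨ cong (iterate alt x) period≡ ⟩
            iterate alt x (suc n)     ≡⟨ iterate-suc alt x n ⟩
            alt (iterate alt x n)     ≡⟨ cong (alt ∘ iterate alt x) i≡n ⟨
            alt (cycleVertex i)          ∎
            where open ≡-Reasoning

          ≅Cycle : G ≅ Cycle n
          ≅Cycle = ≅-from-bijections {H = Cycle n} cycleVertex cycleEdge
            (cycleVertex-injective , cycleVertex-surjective) (cycleEdge-injective , cycleEdge-surjective)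
            (λ i → subst (Joins G (cycleEdge i) (cycleVertex i)) (sym (cycleVertex-next i))
                         (alt-joins (cycleVertex i)))

        ≅EvenCycle : ∃[ j ] (G ≅ EvenCycle j)
        ≅EvenCycle = let j , period≡ = Even-suc period-even in j , ≅Cycle period≡

      module SingleEdge (x : Vertex G) (e₀ : Edge G) (x∈e₀ : Incident G x e₀)
        (only-e₀ : ∀ {e} → Incident G x e → e ≡ e₀) where

        x′ : Vertex G
        x′ = otherEnd e₀ x

        x-x′ : Joins G e₀ x x′
        x-x′ = Incident⇒Joins-otherEnd x∈e₀

        -- a perfect matching through any edge at x′ must cover x by e₀, hence x′ by e₀
        only-e₀-at-x′ : Incident G x′ e → e ≡ e₀
        only-e₀-at-x′ {e} x′∈e = trans (sym (edgeAt-matchingThrough mc x′∈e))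
          (sym (Mₑ.edgeAt-unique e₀∈Mₑ (Joins⇒Incidentʳ x-x′)))
          where
          module Mₑ = PerfectMatching (matchingThrough mc e)
          e₀∈Mₑ : Mₑ.member e₀ ≡ true
          e₀∈Mₑ = subst (λ d → Mₑ.member d ≡ true) (only-e₀ (Mₑ.edgeAt-incident x))
                        (Mₑ.edgeAt-member x)

        Endpoint : Vertex G → Set
        Endpoint z = z ≡ x ⊎ z ≡ x′

        only-e₀-at-endpoint : Endpoint z → Incident G z e → e ≡ e₀
        only-e₀-at-endpoint (inj₁ refl) = only-e₀
        only-e₀-at-endpoint (inj₂ refl) = only-e₀-at-x′

        Endpoint-step : Endpoint a → Joins G e a b → Endpoint b
        Endpoint-step end j with only-e₀-at-endpoint end (Joins⇒Incidentˡ j)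
        ... | refl = Joins-ends x-x′ (Joins⇒Incidentʳ j)

        all-endpoints : ∀ z → Endpoint z
        all-endpoints = Connected-closed (proj₁ mc) Endpoint Endpoint-step (inj₁ refl)

        all-e₀ : ∀ e → e ≡ e₀
        all-e₀ e = only-e₀-at-endpoint (all-endpoints (proj₁ (ends G e))) (inj₁ refl)

        x≢x′ : x ≢ x′
        x≢x′ x≡x′ = not-¬ refl (trans (cong colour x≡x′) (Joins-colour x-x′))

        endpoint : Fin 2 → Vertex G
        endpoint Fin.zero = x
        endpoint (Fin.suc _) = x′

        endpoint-injective : Injective _≡_ _≡_ endpoint
        endpoint-injective {Fin.zero} {Fin.zero} _ = refl
        endpoint-injective {Fin.zero} {Fin.suc Fin.zero} x≡x′ = ⊥-elim (x≢x′ x≡x′)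
        endpoint-injective {Fin.suc Fin.zero} {Fin.zero} x′≡x = ⊥-elim (x≢x′ (sym x′≡x))
        endpoint-injective {Fin.suc Fin.zero} {Fin.suc Fin.zero} _ = refl

        endpoint-surjective : Surjective _≡_ _≡_ endpoint
        endpoint-surjective z = [ (λ z≡x → Fin.zero , λ { refl → sym z≡x })
                                , (λ z≡x′ → Fin.suc Fin.zero , λ { refl → sym z≡x′ }) ]′ (all-endpoints z)

        ≅K₂ : G ≅ K₂
        ≅K₂ = ≅-from-bijections {H = K₂} endpoint (λ _ → e₀)
          (endpoint-injective , endpoint-surjective)
          ((λ { {Fin.zero} {Fin.zero} _ → refl }) , λ e → Fin.zero , λ { refl → sym (all-e₀ e) })
          (λ _ → x-x′)

      private
        two : 2 ≤ V G
        two = proj₁ (proj₂ mc)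

        start other : Vertex G
        start = fromℕ< (≤-trans (s≤s z≤n) two)
        other = fromℕ< two

        start≢other : start ≢ other
        start≢other eq = 0≢1+n (trans (sym (toℕ-fromℕ< (≤-trans (s≤s z≤n) two)))
                                      (trans (cong toℕ eq) (toℕ-fromℕ< two)))

        e₀ : Edge G
        e₀ = proj₁ (firstEdge start≢other (proj₁ mc start other))

        start∈e₀ : Incident G start e₀
        start∈e₀ = proj₁ (proj₂ (firstEdge start≢other (proj₁ mc start other)))

      classification : (G ≅ K₂) ⊎ ∃[ j ] (G ≅ EvenCycle j)
      classification with any? (λ e → Incident? start e ×-dec ¬? (e ≟ᶠ e₀))
      ... | yes (e₁ , start∈e₁ , e₁≢e₀) =
        inj₂ (SpanningCycle.≅EvenCycle start e₀ e₁ start∈e₀ start∈e₁ (e₁≢e₀ ∘ sym))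
      ... | no no-other = inj₁ (SingleEdge.≅K₂ start e₀ start∈e₀ only-e₀)
        where
        only-e₀ : Incident G start e → e ≡ e₀
        only-e₀ {e} start∈e with e ≟ᶠ e₀
        ... | yes e≡e₀ = e≡e₀
        ... | no e≢e₀ = ⊥-elim (no-other (e , start∈e , e≢e₀))

Degree≥3-transport : ∀ {G H} → G ≅ H → Degree≥3 G → Degree≥3 H
Degree≥3-transport {G} {H} (f , g , joins) d = record
  { centre = Inverse.to f centre
  ; incident₁ = incident incident₁ ; incident₂ = incident incident₂ ; incident₃ = incident incident₃
  ; edge₁≢edge₂ = edge₁≢edge₂ ∘ g-injective
  ; edge₁≢edge₃ = edge₁≢edge₃ ∘ g-injective
  ; edge₂≢edge₃ = edge₂≢edge₃ ∘ g-injective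
  }
  where
  open Degree≥3 d

  g-injective : Injective _≡_ _≡_ (Inverse.to g)
  g-injective = Injection.injective (↔⇒↣ g)

  incident : ∀ {e} → Incident G centre e → Incident H (Inverse.to f centre) (Inverse.to g e)
  incident {e} (inj₁ eq) = subst (λ c → Incident H (Inverse.to f c) _) eq (Joins⇒Incidentˡ H (joins e))
  incident {e} (inj₂ eq) = subst (λ c → Incident H (Inverse.to f c) _) eq (Joins⇒Incidentʳ H (joins e))

¬Degree≥3-K₂ : ¬ Degree≥3 K₂
¬Degree≥3-K₂ record { edge₁ = Fin.zero ; edge₂ = Fin.zero ; edge₁≢edge₂ = edge₁≢edge₂ } =
  edge₁≢edge₂ refl

¬Degree≥3-Cycle : ∀ n → ¬ Degree≥3 (Cycle n)
¬Degree≥3-Cycle n d = two-coincide incident₁ incident₂ incident₃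
  where
  open Degree≥3 d

  two-coincide : Incident (Cycle n) centre edge₁ → Incident (Cycle n) centre edge₂ →
    Incident (Cycle n) centre edge₃ → ⊥
  two-coincide (inj₁ e₁≡) (inj₁ e₂≡) _ = edge₁≢edge₂ (trans e₁≡ (sym e₂≡))
  two-coincide (inj₁ e₁≡) (inj₂ _) (inj₁ e₃≡) = edge₁≢edge₃ (trans e₁≡ (sym e₃≡))
  two-coincide (inj₁ _) (inj₂ e₂≡) (inj₂ e₃≡) = edge₂≢edge₃ (next-injective (trans e₂≡ (sym e₃≡)))
  two-coincide (inj₂ e₁≡) (inj₂ e₂≡) _ = edge₁≢edge₂ (next-injective (trans e₁≡ (sym e₂≡)))
  two-coincide (inj₂ _) (inj₁ e₂≡) (inj₁ e₃≡) = edge₂≢edge₃ (trans e₂≡ (sym e₃≡))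
  two-coincide (inj₂ e₁≡) (inj₁ _) (inj₂ e₃≡) = edge₁≢edge₃ (next-injective (trans e₁≡ (sym e₃≡)))

proposition11 : (G : Graph) → Loopless G → Bipartite G → MatchingCovered G →
    (ThetaFree G → (G ≅ K₂) ⊎ (∃[ j ] (G ≅ EvenCycle j))) ×
    ((G ≅ K₂) ⊎ (∃[ j ] (G ≅ EvenCycle j)) → ThetaFree G)
proposition11 G _ bip mc = classify , ¬Degree≥3⇒ThetaFree G ∘ no-branching
  where
  classify : ThetaFree G → (G ≅ K₂) ⊎ (∃[ j ] (G ≅ EvenCycle j))
  classify θ-free = MaxDegreeTwo.classification G bip mc λ d → Degree≥3⇒¬ThetaFree G bip mc d θ-free

  no-branching : (G ≅ K₂) ⊎ (∃[ j ] (G ≅ EvenCycle j)) → ¬ Degree≥3 G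
  no-branching (inj₁ G≅K₂) = ¬Degree≥3-K₂ ∘ Degree≥3-transport G≅K₂
  no-branching (inj₂ (j , G≅C)) = ¬Degree≥3-Cycle (suc (2 * j)) ∘ Degree≥3-transport G≅C
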